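{- Let $n$ be a positive integer and $F\subseteq E(K_n)$. Then $S_F$ is a dual mutual-visibility set of $L(K_n)$ if and only if the graph $(K_n)_F$ contains neither $K_4$ nor $C_4$ as an induced subgraph.
   Context: $L(K_n)$ is the line graph of $K_n$, with vertex set $\{e_{uv}: uv\in E(K_n)\}$, $e_{uv}$ and $e_{u'v'}$ adjacent iff the edges share an endpoint. For $F\subseteq E(K_n)$, $S_F=\{e_{uv}: uv\in F\}$ and $(K_n)_F$ is the subgraph of $K_n$ with edge set $F$ and vertex set the endpoints of edges in $F$. For a connected graph $H$ and $X\subseteq V(H)$, two vertices are $X$-visible if there is a shortest path between them whose internal vertices are not in $X$; $X$ is a dual mutual-visibility set if every two vertices of $X$ are $X$-visible and every two vertices of $V(H)\setminus X$ are $X$-visible. -}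

module Defs where

open import Data.Nat using (ℕ; zero; suc; _≤_)
open import Data.Fin using (Fin; _<_)
open import Data.Bool using (Bool; T)
open import Data.Product using (Σ; ∃; _×_; _,_)
open import Data.Sum using (_⊎_)
open import Data.Empty using (⊥)
open import Relation.Nullary using (¬_)
open import Relation.Binary.PropositionalEquality using (_≡_; _≢_)

data AvoidWalk {V : Set} (Adj : V → V → Set) (X : V → Set) : V → V → ℕ → Set where
  nil  : ∀ {u} → AvoidWalk Adj X u u zero
  one  : ∀ {u v} → Adj u v → AvoidWalk Adj X u v (suc zero)
  cons : ∀ {u w v k} → Adj u w → ¬ X w → AvoidWalk Adj X w v (suc k) →
         AvoidWalk Adj X u v (suc (suc k))

Walk : {V : Set} (Adj : V → V → Set) → V → V → ℕ → Set
Walk Adj = AvoidWalk Adj (λ _ → ⊥)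

-- u and v are X-visible: there is a shortest u,v-path (a walk of length k
-- such that every u,v-walk has length ≥ k; such a walk is a path) whose
-- internal vertices are not in X.
Visible : {V : Set} (Adj : V → V → Set) (X : V → Set) → V → V → Set
Visible Adj X u v =
  Σ ℕ λ k → AvoidWalk Adj X u v k × (∀ m → Walk Adj u v m → k ≤ m)

DualMutualVisibility : {V : Set} (Adj : V → V → Set) (X : V → Set) → Set
DualMutualVisibility Adj X =
  (∀ u v → X u → X v → Visible Adj X u v) ×
  (∀ u v → ¬ X u → ¬ X v → Visible Adj X u v)

-- K_n on vertex set Fin n; its edges uv are stored with u < v.

record Edge (n : ℕ) : Set where
  constructor edge
  field
    lo  : Fin n
    hi  : Fin n
    lo<hi : lo < hi
open Edge public

LAdj : (n : ℕ) → Edge n → Edge n → Set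
LAdj n e f =
  ¬ (lo e ≡ lo f × hi e ≡ hi f) ×
  (lo e ≡ lo f ⊎ lo e ≡ hi f ⊎ hi e ≡ lo f ⊎ hi e ≡ hi f)

S : {n : ℕ} → (Edge n → Bool) → Edge n → Set
S F e = T (F e)

FAdj : {n : ℕ} → (Edge n → Bool) → Fin n → Fin n → Set
FAdj F i j = (Σ (i < j) λ p → T (F (edge i j p))) ⊎ (Σ (j < i) λ p → T (F (edge j i p)))

-- (K_n)_F contains K₄ as an induced subgraph (any four pairwise-adjacent
-- vertices are endpoints of F-edges, hence vertices of (K_n)_F).
HasInducedK4 : {n : ℕ} → (Edge n → Bool) → Set
HasInducedK4 {n} F = Σ (Fin n) λ a → Σ (Fin n) λ b → Σ (Fin n) λ c → Σ (Fin n) λ d →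
  (a ≢ b × a ≢ c × a ≢ d × b ≢ c × b ≢ d × c ≢ d) ×
  (FAdj F a b × FAdj F a c × FAdj F a d × FAdj F b c × FAdj F b d × FAdj F c d)

HasInducedC4 : {n : ℕ} → (Edge n → Bool) → Set
HasInducedC4 {n} F = Σ (Fin n) λ a → Σ (Fin n) λ b → Σ (Fin n) λ c → Σ (Fin n) λ d →
  (a ≢ b × a ≢ c × a ≢ d × b ≢ c × b ≢ d × c ≢ d) ×
  (FAdj F a b × FAdj F b c × FAdj F c d × FAdj F d a) ×
  (¬ FAdj F a c × ¬ FAdj F b d)

-- In L(K_n) two distinct edges are at distance 1 when they share an
-- endpoint and at distance 2 otherwise, and the inner vertices of the
-- shortest paths between disjoint edges ab and cd are exactly the four
-- cross edges ac, ad, bc, bd.  Hence S_F fails to be a dual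
-- mutual-visibility set exactly when two disjoint edges lying on the same
-- side of F have all four cross edges in F.  If both edges are in F,
-- {a, b, c, d} spans a K₄ of (K_n)_F; if neither is, a-c-b-d-a is an
-- induced C₄.  Conversely an induced K₄ or C₄ yields such a pair.
module Submission where

open import Defs
open import Data.Nat using (ℕ; _≤_; z≤n; s≤s)
open import Data.Fin using (Fin)
open import Data.Fin.Properties using (_≟_; <-cmp; <-asym; <-irrelevant; <⇒≢)
open import Data.Bool using (Bool; T; T?)
open import Data.Product using (Σ; _×_; _,_; proj₁; proj₂)
open import Data.Sum using (_⊎_; inj₁; inj₂; [_,_]′; swap)
open import Data.Empty using (⊥-elim)
open import Function using (_∘_; id)
open import Function.Bundles using (_⇔_; mk⇔)
open import Relation.Nullary using (¬_; yes; no)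
open import Relation.Binary.PropositionalEquality
  using (_≡_; _≢_; refl; sym; trans; cong; subst; ≢-sym)
open import Relation.Binary.Definitions using (tri<; tri≈; tri>)

module _ {V : Set} {Adj : V → V → Set} {X : V → Set} where

  visible-refl : ∀ {u} → Visible Adj X u u
  visible-refl = 0 , nil , λ _ _ → z≤n

  walk-length-≥1 : ∀ {u v m} → u ≢ v → Walk Adj u v m → 1 ≤ m
  walk-length-≥1 u≢v nil          = ⊥-elim (u≢v refl)
  walk-length-≥1 u≢v (one _)      = s≤s z≤n
  walk-length-≥1 u≢v (cons _ _ _) = s≤s z≤n

  walk-length-≥2 : ∀ {u v m} → u ≢ v → ¬ Adj u v → Walk Adj u v m → 2 ≤ m
  walk-length-≥2 u≢v ¬uv nil          = ⊥-elim (u≢v refl)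
  walk-length-≥2 u≢v ¬uv (one uv)     = ⊥-elim (¬uv uv)
  walk-length-≥2 u≢v ¬uv (cons _ _ _) = s≤s (s≤s z≤n)

  visible-adjacent : ∀ {u v} → u ≢ v → Adj u v → Visible Adj X u v
  visible-adjacent u≢v uv = 1 , one uv , λ _ → walk-length-≥1 u≢v

  visible-at-distance-2 : ∀ {u v w} → u ≢ v → ¬ Adj u v →
    Adj u w → ¬ X w → Adj w v → Visible Adj X u v
  visible-at-distance-2 u≢v ¬uv uw w∉X wv =
    2 , cons uw w∉X (one wv) , λ _ → walk-length-≥2 u≢v ¬uv

  no-avoiding-walk-within-2 : ∀ {u v k} → u ≢ v → ¬ Adj u v →
    (∀ {w} → Adj u w → Adj w v → X w) → AvoidWalk Adj X u v k → ¬ k ≤ 2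
  no-avoiding-walk-within-2 u≢v ¬uv blocked nil _ = u≢v refl
  no-avoiding-walk-within-2 u≢v ¬uv blocked (one uv) _ = ¬uv uv
  no-avoiding-walk-within-2 u≢v ¬uv blocked (cons uw w∉X (one wv)) _ = w∉X (blocked uw wv)
  no-avoiding-walk-within-2 u≢v ¬uv blocked (cons _ _ (cons _ _ _)) (s≤s (s≤s ()))

  invisible-at-distance-2 : ∀ {u v} → u ≢ v → ¬ Adj u v → Walk Adj u v 2 →
    (∀ {w} → Adj u w → Adj w v → X w) → ¬ Visible Adj X u v
  invisible-at-distance-2 u≢v ¬uv walk blocked (_ , p , shortest) =
    no-avoiding-walk-within-2 u≢v ¬uv blocked p (shortest 2 walk)

data Joins {n : ℕ} (e : Edge n) : Fin n → Fin n → Set where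
  lo-hi : Joins e (lo e) (hi e)
  hi-lo : Joins e (hi e) (lo e)

_∈ₑ_ : {n : ℕ} → Fin n → Edge n → Set
x ∈ₑ e = x ≡ lo e ⊎ x ≡ hi e

Share : {n : ℕ} → Edge n → Edge n → Set
Share e f = lo e ≡ lo f ⊎ lo e ≡ hi f ⊎ hi e ≡ lo f ⊎ hi e ≡ hi f

Disjoint : {n : ℕ} → Fin n → Fin n → Fin n → Fin n → Set
Disjoint a b c d = a ≢ c × a ≢ d × b ≢ c × b ≢ d

CrossEdge : {n : ℕ} → Edge n → Fin n → Fin n → Fin n → Fin n → Set
CrossEdge w a b c d = Joins w a c ⊎ Joins w a d ⊎ Joins w b c ⊎ Joins w b d

CrossComplete : {n : ℕ} → (Edge n → Bool) → Fin n → Fin n → Fin n → Fin n → Set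
CrossComplete F a b c d = FAdj F a c × FAdj F a d × FAdj F b c × FAdj F b d

module _ {n : ℕ} where

  edge-≡ : {e f : Edge n} → lo e ≡ lo f → hi e ≡ hi f → e ≡ f
  edge-≡ {edge l h p} {edge .l .h q} refl refl = cong (edge l h) (<-irrelevant p q)

  edge-between : (a b : Fin n) → a ≢ b → Σ (Edge n) λ e → Joins e a b
  edge-between a b a≢b with <-cmp a b
  ... | tri< a<b _ _ = edge a b a<b , lo-hi
  ... | tri≈ _ a≡b _ = ⊥-elim (a≢b a≡b)
  ... | tri> _ _ b<a = edge b a b<a , hi-lo

  Joins-sym : ∀ {e : Edge n} {a b} → Joins e a b → Joins e b a
  Joins-sym lo-hi = hi-lo
  Joins-sym hi-lo = lo-hi

  joins-distinct : ∀ {e : Edge n} {a b} → Joins e a b → a ≢ b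
  joins-distinct {e} lo-hi = <⇒≢ (lo<hi e)
  joins-distinct {e} hi-lo = ≢-sym (<⇒≢ (lo<hi e))

  joins-∈ₑ : ∀ {e : Edge n} {a b} → Joins e a b → a ∈ₑ e
  joins-∈ₑ lo-hi = inj₁ refl
  joins-∈ₑ hi-lo = inj₂ refl

  ∈ₑ-joins : ∀ {e : Edge n} {a b x} → Joins e a b → x ∈ₑ e → x ≡ a ⊎ x ≡ b
  ∈ₑ-joins lo-hi = id
  ∈ₑ-joins hi-lo = swap

  two-endpoints-join : ∀ {e : Edge n} {x y} → x ∈ₑ e → y ∈ₑ e → x ≢ y → Joins e x y
  two-endpoints-join (inj₁ refl) (inj₁ refl) x≢y = ⊥-elim (x≢y refl)
  two-endpoints-join (inj₁ refl) (inj₂ refl) _   = lo-hi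
  two-endpoints-join (inj₂ refl) (inj₁ refl) _   = hi-lo
  two-endpoints-join (inj₂ refl) (inj₂ refl) x≢y = ⊥-elim (x≢y refl)

  share⇒common-endpoint : {e f : Edge n} → Share e f → Σ (Fin n) λ x → x ∈ₑ e × x ∈ₑ f
  share⇒common-endpoint {e} (inj₁ p)               = lo e , inj₁ refl , inj₁ p
  share⇒common-endpoint {e} (inj₂ (inj₁ p))        = lo e , inj₁ refl , inj₂ p
  share⇒common-endpoint {e} (inj₂ (inj₂ (inj₁ p))) = hi e , inj₂ refl , inj₁ p
  share⇒common-endpoint {e} (inj₂ (inj₂ (inj₂ p))) = hi e , inj₂ refl , inj₂ p

  common-endpoint⇒share : ∀ {e f : Edge n} {x} → x ∈ₑ e → x ∈ₑ f → Share e f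
  common-endpoint⇒share (inj₁ p) (inj₁ q) = inj₁ (trans (sym p) q)
  common-endpoint⇒share (inj₁ p) (inj₂ q) = inj₂ (inj₁ (trans (sym p) q))
  common-endpoint⇒share (inj₂ p) (inj₁ q) = inj₂ (inj₂ (inj₁ (trans (sym p) q)))
  common-endpoint⇒share (inj₂ p) (inj₂ q) = inj₂ (inj₂ (inj₂ (trans (sym p) q)))

  LAdj-irrefl : {e f : Edge n} → LAdj n e f → e ≢ f
  LAdj-irrefl (distinct , _) refl = distinct (refl , refl)

  adjacent-at : ∀ {e w : Edge n} {x y z} → Joins e x y → Joins w x z → y ≢ z → LAdj n e w
  adjacent-at {e} {w} {y = y} je jw y≢z =
    different , common-endpoint⇒share {e} {w} (joins-∈ₑ je) (joins-∈ₑ jw)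
    where
    different : ¬ (lo e ≡ lo w × hi e ≡ hi w)
    different (lo≡ , hi≡) =
      [ (λ y≡x → joins-distinct je (sym y≡x)) , y≢z ]′
        (∈ₑ-joins jw (subst (y ∈ₑ_) (edge-≡ {e} {w} lo≡ hi≡) (joins-∈ₑ (Joins-sym je))))

  equal-adjacent-or-disjoint : (e f : Edge n) →
    e ≡ f ⊎ LAdj n e f ⊎ Disjoint (lo e) (hi e) (lo f) (hi f)
  equal-adjacent-or-disjoint e f with lo e ≟ lo f | hi e ≟ hi f | lo e ≟ hi f | hi e ≟ lo f
  ... | yes p | yes q | _     | _     = inj₁ (edge-≡ p q)
  ... | yes p | no q  | _     | _     = inj₂ (inj₁ (q ∘ proj₂ , inj₁ p))
  ... | no p  | yes q | _     | _     = inj₂ (inj₁ (p ∘ proj₁ , inj₂ (inj₂ (inj₂ q))))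
  ... | no p  | no q  | yes r | _     = inj₂ (inj₁ (p ∘ proj₁ , inj₂ (inj₁ r)))
  ... | no p  | no q  | no r  | yes s = inj₂ (inj₁ (p ∘ proj₁ , inj₂ (inj₂ (inj₁ s))))
  ... | no p  | no q  | no r  | no s  = inj₂ (inj₂ (p , r , s , q))

  module _ {a b c d : Fin n} where

    Disjoint-swapˡ : Disjoint a b c d → Disjoint b a c d
    Disjoint-swapˡ (ac , ad , bc , bd) = bc , bd , ac , ad

    Disjoint-swapʳ : Disjoint a b c d → Disjoint a b d c
    Disjoint-swapʳ (ac , ad , bc , bd) = ad , ac , bd , bc

    disjoint-apart : ∀ {x y} → Disjoint a b c d → x ≡ a ⊎ x ≡ b → y ≡ c ⊎ y ≡ d → x ≢ y
    disjoint-apart (ac , _  , _  , _ ) (inj₁ refl) (inj₁ refl) = ac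
    disjoint-apart (_  , ad , _  , _ ) (inj₁ refl) (inj₂ refl) = ad
    disjoint-apart (_  , _  , bc , _ ) (inj₂ refl) (inj₁ refl) = bc
    disjoint-apart (_  , _  , _  , bd) (inj₂ refl) (inj₂ refl) = bd

  module _ {a b c d : Fin n} {e f : Edge n}
           (D : Disjoint a b c d) (je : Joins e a b) (jf : Joins f c d) where

    disjoint-no-share : ¬ Share e f
    disjoint-no-share s with share⇒common-endpoint {e} {f} s
    ... | x , x∈e , x∈f = disjoint-apart D (∈ₑ-joins je x∈e) (∈ₑ-joins jf x∈f) refl

    disjoint-distinct : e ≢ f
    disjoint-distinct refl = disjoint-no-share (inj₁ refl)

    disjoint-nonadjacent : ¬ LAdj n e f
    disjoint-nonadjacent = disjoint-no-share ∘ proj₂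

    cross-edge-adjacent : ∀ {w} → Joins w a c → LAdj n e w × LAdj n w f
    cross-edge-adjacent jw =
      adjacent-at je jw (proj₁ (proj₂ (proj₂ D))) ,
      adjacent-at (Joins-sym jw) jf (proj₁ (proj₂ D))

  cross-edge : ∀ {w : Edge n} {a b c d x y} →
    x ≡ a ⊎ x ≡ b → y ≡ c ⊎ y ≡ d → Joins w x y → CrossEdge w a b c d
  cross-edge (inj₁ refl) (inj₁ refl) j = inj₁ j
  cross-edge (inj₁ refl) (inj₂ refl) j = inj₂ (inj₁ j)
  cross-edge (inj₂ refl) (inj₁ refl) j = inj₂ (inj₂ (inj₁ j))
  cross-edge (inj₂ refl) (inj₂ refl) j = inj₂ (inj₂ (inj₂ j))

  common-neighbour-is-cross : ∀ {a b c d} {e f w : Edge n} → Disjoint a b c d →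
    Joins e a b → Joins f c d → LAdj n e w → LAdj n w f → CrossEdge w a b c d
  common-neighbour-is-cross {e = e} {f} {w} D je jf (_ , ew) (_ , wf)
    with share⇒common-endpoint {e} {w} ew | share⇒common-endpoint {w} {f} wf
  ... | x , x∈e , x∈w | y , y∈w , y∈f =
    cross-edge x∈ab y∈cd (two-endpoints-join x∈w y∈w (disjoint-apart D x∈ab y∈cd))
    where
    x∈ab = ∈ₑ-joins je x∈e
    y∈cd = ∈ₑ-joins jf y∈f

module _ {n : ℕ} (F : Edge n → Bool) where

  FAdj-sym : ∀ {a b} → FAdj F a b → FAdj F b a
  FAdj-sym = swap

  ∈F⇒FAdj : ∀ {w a b} → Joins w a b → T (F w) → FAdj F a b
  ∈F⇒FAdj {w} lo-hi w∈F = inj₁ (lo<hi w , w∈F)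
  ∈F⇒FAdj {w} hi-lo w∈F = inj₂ (lo<hi w , w∈F)

  FAdj⇒∈F : ∀ {w a b} → Joins w a b → FAdj F a b → T (F w)
  FAdj⇒∈F {w} lo-hi (inj₁ (p , t)) = subst (λ q → T (F (edge (lo w) (hi w) q))) (<-irrelevant p (lo<hi w)) t
  FAdj⇒∈F {w} lo-hi (inj₂ (p , _)) = ⊥-elim (<-asym p (lo<hi w))
  FAdj⇒∈F {w} hi-lo (inj₁ (p , _)) = ⊥-elim (<-asym p (lo<hi w))
  FAdj⇒∈F {w} hi-lo (inj₂ (p , t)) = subst (λ q → T (F (edge (lo w) (hi w) q))) (<-irrelevant p (lo<hi w)) t

  module _ {a b c d : Fin n} {e f : Edge n}
           (D : Disjoint a b c d) (je : Joins e a b) (jf : Joins f c d) where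

    cross-complete-invisible : CrossComplete F a b c d → ¬ Visible (LAdj n) (S F) e f
    cross-complete-invisible (Fac , Fad , Fbc , Fbd) =
      invisible-at-distance-2 (disjoint-distinct D je jf) (disjoint-nonadjacent D je jf) walk blocked
      where
      ac = edge-between a c (proj₁ D)
      walk : Walk (LAdj n) e f 2
      walk = let ew , wf = cross-edge-adjacent D je jf (proj₂ ac) in cons {w = proj₁ ac} ew (λ ()) (one wf)
      blocked : ∀ {w} → LAdj n e w → LAdj n w f → T (F w)
      blocked ew wf with common-neighbour-is-cross D je jf ew wf
      ... | inj₁ jw               = FAdj⇒∈F jw Fac
      ... | inj₂ (inj₁ jw)        = FAdj⇒∈F jw Fad
      ... | inj₂ (inj₂ (inj₁ jw)) = FAdj⇒∈F jw Fbc
      ... | inj₂ (inj₂ (inj₂ jw)) = FAdj⇒∈F jw Fbd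

    visible-or-FAdj : Visible (LAdj n) (S F) e f ⊎ FAdj F a c
    visible-or-FAdj with edge-between a c (proj₁ D)
    ... | w , jw with T? (F w)
    ...   | yes w∈F = inj₂ (∈F⇒FAdj jw w∈F)
    ...   | no w∉F  =
      let ew , wf = cross-edge-adjacent D je jf jw in
      inj₁ (visible-at-distance-2 (disjoint-distinct D je jf) (disjoint-nonadjacent D je jf) ew w∉F wf)

  visible-or-cross-complete : ∀ {a b c d} {e f : Edge n} → Disjoint a b c d →
    Joins e a b → Joins f c d → Visible (LAdj n) (S F) e f ⊎ CrossComplete F a b c d
  visible-or-cross-complete D je jf
    with visible-or-FAdj D je jf
       | visible-or-FAdj (Disjoint-swapʳ D) je (Joins-sym jf)
       | visible-or-FAdj (Disjoint-swapˡ D) (Joins-sym je) jf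
       | visible-or-FAdj (Disjoint-swapˡ (Disjoint-swapʳ D)) (Joins-sym je) (Joins-sym jf)
  ... | inj₁ vis | _        | _        | _        = inj₁ vis
  ... | _        | inj₁ vis | _        | _        = inj₁ vis
  ... | _        | _        | inj₁ vis | _        = inj₁ vis
  ... | _        | _        | _        | inj₁ vis = inj₁ vis
  ... | inj₂ ac  | inj₂ ad  | inj₂ bc  | inj₂ bd  = inj₂ (ac , ad , bc , bd)

  module _ {a b c d : Fin n} (a≢b : a ≢ b) (c≢d : c ≢ d) (D : Disjoint a b c d) where

    cross-complete-K4 : FAdj F a b → FAdj F c d → CrossComplete F a b c d → HasInducedK4 F
    cross-complete-K4 Fab Fcd (Fac , Fad , Fbc , Fbd) =
      let ac , ad , bc , bd = D in
      a , b , c , d , (a≢b , ac , ad , bc , bd , c≢d) , (Fab , Fac , Fad , Fbc , Fbd , Fcd)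

    cross-complete-C4 : ¬ FAdj F a b → ¬ FAdj F c d → CrossComplete F a b c d → HasInducedC4 F
    cross-complete-C4 ¬Fab ¬Fcd (Fac , Fad , Fbc , Fbd) =
      let ac , ad , bc , bd = D in
      a , c , b , d , (ac , a≢b , ad , ≢-sym bc , c≢d , bd) ,
      (Fac , FAdj-sym Fbc , Fbd , FAdj-sym Fad) , (¬Fab , ¬Fcd)

  dual-visibility⇒no-K4 : DualMutualVisibility (LAdj n) (S F) → ¬ HasInducedK4 F
  dual-visibility⇒no-K4 (inside , _)
    (a , b , c , d , (ab , ac , ad , bc , bd , cd) , (Fab , Fac , Fad , Fbc , Fbd , Fcd))
    with edge-between a b ab | edge-between c d cd
  ... | e , je | f , jf =
    cross-complete-invisible (ac , ad , bc , bd) je jf (Fac , Fad , Fbc , Fbd)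
      (inside e f (FAdj⇒∈F je Fab) (FAdj⇒∈F jf Fcd))

  dual-visibility⇒no-C4 : DualMutualVisibility (LAdj n) (S F) → ¬ HasInducedC4 F
  dual-visibility⇒no-C4 (_ , outside)
    (a , b , c , d , (ab , ac , ad , bc , bd , cd) , (Fab , Fbc , Fcd , Fda) , (¬Fac , ¬Fbd))
    with edge-between a c ac | edge-between b d bd
  ... | e , je | f , jf =
    cross-complete-invisible (ab , ad , ≢-sym bc , cd) je jf (Fab , FAdj-sym Fda , FAdj-sym Fbc , Fcd)
      (outside e f (¬Fac ∘ ∈F⇒FAdj je) (¬Fbd ∘ ∈F⇒FAdj jf))

  SameSide : Edge n → Edge n → Set
  SameSide u v = (S F u × S F v) ⊎ (¬ S F u × ¬ S F v)

  no-K4-C4⇒visible : ¬ HasInducedK4 F → ¬ HasInducedC4 F →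
    ∀ u v → SameSide u v → Visible (LAdj n) (S F) u v
  no-K4-C4⇒visible noK4 noC4 u v side with equal-adjacent-or-disjoint u v
  ... | inj₁ refl      = visible-refl
  ... | inj₂ (inj₁ uv) = visible-adjacent (LAdj-irrefl uv) uv
  ... | inj₂ (inj₂ D)  = [ id , ⊥-elim ∘ K4-or-C4 side ]′ (visible-or-cross-complete D lo-hi lo-hi)
    where
    lo≢hi : ∀ e → lo e ≢ hi e
    lo≢hi e = <⇒≢ (lo<hi e)
    K4-or-C4 : SameSide u v → ¬ CrossComplete F (lo u) (hi u) (lo v) (hi v)
    K4-or-C4 (inj₁ (u∈F , v∈F)) = noK4 ∘ cross-complete-K4 (lo≢hi u) (lo≢hi v) D
      (∈F⇒FAdj {u} lo-hi u∈F) (∈F⇒FAdj {v} lo-hi v∈F)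
    K4-or-C4 (inj₂ (u∉F , v∉F)) = noC4 ∘ cross-complete-C4 (lo≢hi u) (lo≢hi v) D
      (u∉F ∘ FAdj⇒∈F {u} lo-hi) (v∉F ∘ FAdj⇒∈F {v} lo-hi)

theorem3p12 : (n : ℕ) → 1 ≤ n → (F : Edge n → Bool) →
    DualMutualVisibility (LAdj n) (S F) ⇔ (¬ HasInducedK4 F × ¬ HasInducedC4 F)
theorem3p12 n _ F = mk⇔
  (λ dmv → dual-visibility⇒no-K4 F dmv , dual-visibility⇒no-C4 F dmv)
  (λ (noK4 , noC4) →
     (λ u v u∈F v∈F → no-K4-C4⇒visible F noK4 noC4 u v (inj₁ (u∈F , v∈F))) ,
     (λ u v u∉F v∉F → no-K4-C4⇒visible F noK4 noC4 u v (inj₂ (u∉F , v∉F))))
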